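{- For any finite simple graphs $G$ and $H$, (i) $\gamma_R(G\Box H)\ge \frac{\gamma_R(G)\gamma_R(H)}{3}$, and (ii) $\gamma(G\Box H)\ge \frac{\gamma(G)\gamma_R(H)}{3}$.
   Context: $\gamma(X)$ denotes the domination number of a graph $X$ (minimum size of a set $D$ such that every vertex outside $D$ has a neighbor in $D$). A Roman dominating function on $X$ is a map $f:V(X)\to\{0,1,2\}$ such that every vertex $v$ with $f(v)=0$ has a neighbor $u$ with $f(u)=2$; $\gamma_R(X)$ is the minimum of $\sum_v f(v)$ over such $f$. The Cartesian product $G\Box H$ has vertex set $V(G)\times V(H)$, with $(g,h)\sim(g',h')$ iff ($g=g'$ and $h\sim h'$) or ($g\sim g'$ and $h=h'$). -}

module Defs where

open import Data.Nat using (ℕ; _≤_)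
open import Data.Fin using (Fin; toℕ; remQuot; quotient; remainder)
open import Data.Fin.Subset using (Subset; _∈_; _∉_; ∣_∣)
open import Data.List using (map)
open import Data.Nat.ListAction using (sum)
open import Data.List using () renaming (allFin to allFinL)
open import Data.Product using (Σ; ∃; _×_; _,_; proj₁; proj₂)
open import Data.Sum using (_⊎_)
open import Relation.Binary.PropositionalEquality using (_≡_)
open import Relation.Nullary using (¬_)

record Graph : Set₁ where
  field
    n    : ℕ
    Adj  : Fin n → Fin n → Set
    sym  : ∀ {u v} → Adj u v → Adj v u
    irr  : ∀ {v} → ¬ Adj v v
open Graph public

-- Cartesian product G □ H on Fin (n G * n H); a vertex x corresponds to the
-- pair (quotient x , remainder x) ∈ Fin (n G) × Fin (n H) (a bijection).
_□_ : Graph → Graph → Graph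
G □ H = record
  { n   = n G Data.Nat.* n H
  ; Adj = λ x y →
      (fst x ≡ fst y × Adj H (snd x) (snd y)) ⊎ (Adj G (fst x) (fst y) × snd x ≡ snd y)
  ; sym = λ { (Data.Sum.inj₁ (e , a)) → Data.Sum.inj₁ (Relation.Binary.PropositionalEquality.sym e , Graph.sym H a)
            ; (Data.Sum.inj₂ (a , e)) → Data.Sum.inj₂ (Graph.sym G a , Relation.Binary.PropositionalEquality.sym e) }
  ; irr = λ { (Data.Sum.inj₁ (_ , a)) → Graph.irr H a
            ; (Data.Sum.inj₂ (a , _)) → Graph.irr G a }
  }
  where
  import Data.Nat
  fst : Fin (n G Data.Nat.* n H) → Fin (n G)
  fst = quotient {n G} (n H)
  snd : Fin (n G Data.Nat.* n H) → Fin (n H)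
  snd = remainder {n G} (n H)

IsDominating : (G : Graph) → Subset (n G) → Set
IsDominating G D = ∀ v → v ∉ D → ∃ λ u → u ∈ D × Adj G v u

IsDominationNumber : Graph → ℕ → Set
IsDominationNumber G k =
  (∃ λ D → IsDominating G D × ∣ D ∣ ≡ k) × (∀ D → IsDominating G D → k ≤ ∣ D ∣)

IsRomanDominating : (G : Graph) → (Fin (n G) → Fin 3) → Set
IsRomanDominating G f = ∀ v → toℕ (f v) ≡ 0 → ∃ λ u → Adj G v u × toℕ (f u) ≡ 2

weight : (G : Graph) → (Fin (n G) → Fin 3) → ℕ
weight G f = sum (map (λ v → toℕ (f v)) (allFinL (n G)))

IsRomanDominationNumber : Graph → ℕ → Set
IsRomanDominationNumber G k =
  (∃ λ f → IsRomanDominating G f × weight G f ≡ k) × (∀ f → IsRomanDominating G f → k ≤ weight G f)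

-- Take a minimum Roman dominating function φ of G and send every vertex g with φ(g) = 0 to a
-- neighbour owner(g) with φ = 2; this splits V(G) into cells, one for each u with φ(u) > 0.
-- Fix a Roman dominating function F of G □ H. Call the cell of u covered at h ∈ V(H) when F
-- vanishes on it × {h} and each of its vertices is dominated inside the layer G × {h}. For each
-- u, the function on H that is 1 where the cell is covered and min(2, Σ_cell F(·,h)) elsewhere is
-- Roman, so φ(u) γ_R(H) ≤ 2 Σ_cell F + φ(u) #{h : covered}. For each h, the function
-- min(2, F(·,h) + φ on uncovered cells) is Roman on G, so by minimality of φ the φ-mass of the
-- cells covered at h is at most the F-weight of the layer G × {h}. Summing gives
-- w(φ) γ_R(H) ≤ 3 w(F). Only closure of the occurring values under 0, + and capping at 2 is used;
-- for the values {0, 2} (twice a dominating set) this yields the bound on γ(G □ H).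

module Submission where

open import Defs hiding (sym)
open import Data.Nat using (ℕ; zero; suc; _+_; _*_; _≤_; z≤n; s≤s; _≟_; _≡ᵇ_)
open import Data.Nat.Properties
open import Data.Nat.Divisibility using (_∣_; _∣0; ∣-refl; ∣m∣n⇒∣m+n; ∣1⇒≡1)
open import Data.Nat.ListAction using () renaming (sum to sumˡ)
open import Data.Fin using (Fin; zero; suc; toℕ; combine; quotient; remainder; _↑ˡ_; _↑ʳ_)
  renaming (_≟_ to _≟ᶠ_)
open import Data.Fin.Properties
  using (remQuot-combine; combine-remQuot; toℕ<n; toℕ-injective; all?; ¬∀⟶∃¬)
open import Data.Fin.Subset using (Subset; _∈_; _∉_; ∣_∣)
open import Data.Fin.Subset.Properties using (_∈?_)
open import Data.Vec using ([]; _∷_; lookup; tabulate)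
open import Data.Vec.Properties using (lookup∘tabulate; lookup⇒[]=; []=⇒lookup)
import Data.List as List
open import Data.Bool using (Bool; true; false; T; if_then_else_)
open import Data.Bool.Properties using (T-≡)
open import Data.Product using (∃; _×_; _,_; proj₁; proj₂)
open import Data.Sum using (_⊎_; inj₁; inj₂; [_,_]′)
open import Data.Unit using (⊤; tt)
open import Data.Empty using (⊥-elim)
open import Function using (_∘_; id; const; _⇔_; mk⇔; Equivalence)
open import Relation.Binary.PropositionalEquality
  using (_≡_; _≢_; refl; sym; trans; cong; cong₂; subst; module ≡-Reasoning)
open import Relation.Nullary using (Dec; yes; no; does; ¬_; contradiction)
open import Relation.Nullary.Decidable using (T?; _→-dec_; ¬?)
open import Algebra.Properties.Semiring.Sum +-*-semiring
  using ( sum; sum-syntax; sum-cong-≗; sum-replicate-zero; ∑-distrib-+; ∑-comm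
        ; *-distribˡ-sum; *-distribʳ-sum)

[_] : ∀ {a} {A : Set a} → Dec A → ℕ
[ d ] = if does d then 1 else 0

[]-yes : ∀ {a} {A : Set a} (d : Dec A) → A → [ d ] ≡ 1
[]-yes (yes _) _ = refl
[]-yes (no ¬a) a = contradiction a ¬a

*-[]-split : ∀ {a} {A : Set a} x (d : Dec A) → x ≡ x * [ d ] + x * [ ¬? d ]
*-[]-split x (yes _) = sym (trans (cong₂ _+_ (*-identityʳ x) (*-zeroʳ x)) (+-identityʳ x))
*-[]-split x (no _) = sym (trans (cong (_+ x * 1) (*-zeroʳ x)) (*-identityʳ x))

sum-mono-≤ : ∀ {m} {f g : Fin m → ℕ} → (∀ i → f i ≤ g i) → sum f ≤ sum g
sum-mono-≤ {zero}  _   = z≤n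
sum-mono-≤ {suc m} f≤g = +-mono-≤ (f≤g zero) (sum-mono-≤ (f≤g ∘ suc))

≤-sum : ∀ {m} (f : Fin m → ℕ) i → f i ≤ sum f
≤-sum f zero    = m≤m+n (f zero) _
≤-sum f (suc i) = ≤-trans (≤-sum (f ∘ suc) i) (m≤n+m _ (f zero))

sum-↑ : ∀ m {k} (f : Fin (m + k) → ℕ) → sum f ≡ ∑[ i < m ] f (i ↑ˡ k) + ∑[ j < k ] f (m ↑ʳ j)
sum-↑ zero    f = refl
sum-↑ (suc m) f = trans (cong (f zero +_) (sum-↑ m (f ∘ suc))) (sym (+-assoc (f zero) _ _))

sum-combine : ∀ m {k} (f : Fin (m * k) → ℕ) → sum f ≡ ∑[ i < m ] ∑[ j < k ] f (combine i j)
sum-combine zero        f = refl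
sum-combine (suc m) {k} f =
  trans (sum-↑ k f) (cong (∑[ j < k ] f (j ↑ˡ (m * k)) +_) (sum-combine m (f ∘ (k ↑ʳ_))))

sum-δ : ∀ {m} (i : Fin m) x → ∑[ j < m ] ([ i ≟ᶠ j ] * x) ≡ x
sum-δ {suc m} zero    x = trans (cong₂ _+_ (+-identityʳ x) (sum-replicate-zero m)) (+-identityʳ x)
sum-δ         (suc i) x = sum-δ i x

sumˡ-map-tabulate : ∀ {A : Set} {m} (g : Fin m → A) (f : A → ℕ) →
  sumˡ (List.map f (List.tabulate g)) ≡ ∑[ i < m ] f (g i)
sumˡ-map-tabulate {m = zero}  g f = refl
sumˡ-map-tabulate {m = suc m} g f = cong (f (g zero) +_) (sumˡ-map-tabulate (g ∘ suc) f)

weight≡sum : ∀ G (f : Fin (n G) → Fin 3) → weight G f ≡ ∑[ v < n G ] toℕ (f v)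
weight≡sum G f = sumˡ-map-tabulate id (toℕ ∘ f)

clamp : ℕ → Fin 3
clamp 0             = zero
clamp 1             = suc zero
clamp (suc (suc _)) = suc (suc zero)

clamp-≤ : ∀ x → toℕ (clamp x) ≤ x
clamp-≤ 0             = z≤n
clamp-≤ 1             = ≤-refl
clamp-≤ (suc (suc x)) = m≤m+n 2 x

clamp-≡0 : ∀ x → toℕ (clamp x) ≡ 0 → x ≡ 0
clamp-≡0 0             _  = refl
clamp-≡0 1             ()
clamp-≡0 (suc (suc _)) ()

clamp-≡2 : ∀ {x} → 2 ≤ x → toℕ (clamp x) ≡ 2
clamp-≡2 {suc (suc _)} _ = refl
clamp-≡2 {1}           (s≤s ())

quotient-combine : ∀ {m k} (i : Fin m) (j : Fin k) → quotient k (combine i j) ≡ i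
quotient-combine i j = cong proj₁ (remQuot-combine i j)

remainder-combine : ∀ {m k} (i : Fin m) (j : Fin k) → remainder {m} k (combine i j) ≡ j
remainder-combine i j = cong proj₂ (remQuot-combine i j)

combine-quotient : ∀ {m} k (y : Fin (m * k)) {i} →
  quotient {m} k y ≡ i → combine i (remainder {m} k y) ≡ y
combine-quotient {m} k y refl = combine-remQuot {m} k y

combine-remainder : ∀ {m} k (y : Fin (m * k)) {j} →
  remainder {m} k y ≡ j → combine (quotient {m} k y) j ≡ y
combine-remainder {m} k y refl = combine-remQuot {m} k y

roman-□-fibres : ∀ G H {F} → IsRomanDominating (G □ H) F → ∀ g h → toℕ (F (combine g h)) ≡ 0 →
  (∃ λ h′ → Adj H h h′ × toℕ (F (combine g h′)) ≡ 2) ⊎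
  (∃ λ g′ → Adj G g g′ × toℕ (F (combine g′ h)) ≡ 2)
roman-□-fibres G H {F} F-roman g h F≡0 with F-roman (combine g h) F≡0
... | y , inj₁ (same-g , adj) , Fy≡2 =
  inj₁ (_ , subst (λ h₀ → Adj H h₀ _) (remainder-combine g h) adj , trans (cong (toℕ ∘ F) y≡) Fy≡2)
  where
  y≡ : combine g (remainder {n G} (n H) y) ≡ y
  y≡ = combine-quotient {n G} (n H) y (trans (sym same-g) (quotient-combine g h))
... | y , inj₂ (adj , same-h) , Fy≡2 =
  inj₂ (_ , subst (λ g₀ → Adj G g₀ _) (quotient-combine g h) adj , trans (cong (toℕ ∘ F) y≡) Fy≡2)
  where
  y≡ : combine (quotient {n G} (n H) y) h ≡ y
  y≡ = combine-remainder {n G} (n H) y (trans (sym same-h) (remainder-combine g h))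

ValuedIn : ∀ {k} → (ℕ → Set) → (Fin k → Fin 3) → Set
ValuedIn P f = ∀ v → P (toℕ (f v))

MinimalRomanIn : (ℕ → Set) → (G : Graph) → (Fin (n G) → Fin 3) → Set
MinimalRomanIn P G φ = ∀ ψ → IsRomanDominating G ψ → ValuedIn P ψ → weight G φ ≤ weight G ψ

RomanLowerBound : Graph → ℕ → Set
RomanLowerBound H c = ∀ f → IsRomanDominating H f → c ≤ weight H f

record IsClampClosedSubmonoid (P : ℕ → Set) : Set where
  field
    0-closed     : P 0
    +-closed     : ∀ {x y} → P x → P y → P (x + y)
    clamp-closed : ∀ {x} → P x → P (toℕ (clamp x))

  *-[]-closed : ∀ {a} {A : Set a} {x} (d : Dec A) → P x → P (x * [ d ])
  *-[]-closed {x = x} (yes _) Px = subst P (sym (*-identityʳ x)) Px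
  *-[]-closed {x = x} (no _)  _  = subst P (sym (*-zeroʳ x)) 0-closed

module ProductBound
  {P : ℕ → Set} (P-closed : IsClampClosedSubmonoid P) (G H : Graph)
  (φ : Fin (n G) → Fin 3) (φ-roman : IsRomanDominating G φ)
  (φ-valued : ValuedIn P φ) (φ-minimal : MinimalRomanIn P G φ)
  (F : Fin (n G * n H) → Fin 3) (F-roman : IsRomanDominating (G □ H) F)
  (F-valued : ValuedIn P F)
  where

  open IsClampClosedSubmonoid P-closed

  φₙ : Fin (n G) → ℕ
  φₙ g = toℕ (φ g)

  Fₙ : Fin (n G) → Fin (n H) → ℕ
  Fₙ g h = toℕ (F (combine g h))

  φ≤2 : ∀ g → φₙ g ≤ 2
  φ≤2 g = ≤-pred (toℕ<n (φ g))

  owner : Fin (n G) → Fin (n G)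
  owner g with φₙ g ≟ 0
  ... | yes φg≡0 = proj₁ (φ-roman g φg≡0)
  ... | no  _    = g

  owner-fixed : ∀ g → φₙ g ≢ 0 → owner g ≡ g
  owner-fixed g φg≢0 with φₙ g ≟ 0
  ... | yes φg≡0 = contradiction φg≡0 φg≢0
  ... | no  _    = refl

  owner-adj : ∀ g → φₙ g ≡ 0 → Adj G g (owner g) × φₙ (owner g) ≡ 2
  owner-adj g φg≡0 with φₙ g ≟ 0
  ... | yes z    = proj₂ (φ-roman g z)
  ... | no φg≢0  = contradiction φg≡0 φg≢0

  owner-nonzero : ∀ g → φₙ (owner g) ≢ 0
  owner-nonzero g φog≡0 with φₙ g ≟ 0
  ... | yes z    = contradiction (trans (sym (proj₂ (proj₂ (φ-roman g z)))) φog≡0) λ ()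
  ... | no φg≢0  = φg≢0 φog≡0

  owner-idem : ∀ g → owner (owner g) ≡ owner g
  owner-idem g = owner-fixed (owner g) (owner-nonzero g)

  φ-*-owner : ∀ (β : Fin (n G) → ℕ) g → φₙ g * β (owner g) ≡ φₙ g * β g
  φ-*-owner β g with φₙ g ≟ 0
  ... | yes φg≡0 = trans (cong (_* β (proj₁ (φ-roman g φg≡0))) φg≡0) (cong (_* β g) (sym φg≡0))
  ... | no  _    = refl

  GDominated HDominated : Fin (n G) → Fin (n H) → Set
  GDominated g h = ∃ λ g′ → Adj G g g′ × Fₙ g′ h ≡ 2
  HDominated g h = ∃ λ h′ → Adj H h h′ × Fₙ g h′ ≡ 2

  -- Adjacency is not decidable, so whether a zero of F is dominated within its G-layer is read off
  -- the witness that F-roman provides.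
  witnessInG : Fin (n G) → Fin (n H) → Bool
  witnessInG g h with Fₙ g h ≟ 0
  ... | yes F≡0 = [ const false , const true ]′ (roman-□-fibres G H F-roman g h F≡0)
  ... | no  _   = false

  witnessInG-sound : ∀ g h → T (witnessInG g h) → Fₙ g h ≡ 0 × GDominated g h
  witnessInG-sound g h t with Fₙ g h ≟ 0
  ... | no _ = ⊥-elim t
  ... | yes F≡0 with roman-□-fibres G H F-roman g h F≡0
  ...   | inj₁ _   = ⊥-elim t
  ...   | inj₂ dom = F≡0 , dom

  witnessInG-complete : ∀ g h → Fₙ g h ≡ 0 → ¬ T (witnessInG g h) → HDominated g h
  witnessInG-complete g h F≡0 ¬t with Fₙ g h ≟ 0
  ... | no F≢0 = contradiction F≡0 F≢0
  ... | yes z with roman-□-fibres G H F-roman g h z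
  ...   | inj₁ dom = dom
  ...   | inj₂ _   = contradiction tt ¬t

  Covered : Fin (n G) → Fin (n H) → Set
  Covered u h = ∀ g → owner g ≡ u → T (witnessInG g h)

  -- Opaque, so that `with covered? u h` also abstracts it inside `[ covered? u h ]`.
  opaque
    covered? : ∀ u h → Dec (Covered u h)
    covered? u h = all? (λ g → owner g ≟ᶠ u →-dec T? (witnessInG g h))

  uncovered-witness : ∀ {u h} → ¬ Covered u h → ∃ λ g → owner g ≡ u × ¬ T (witnessInG g h)
  uncovered-witness {u} {h} ¬cov
    with ¬∀⟶∃¬ (n G) _ (λ g → owner g ≟ᶠ u →-dec T? (witnessInG g h)) ¬cov
  ... | g , ¬imp with owner g ≟ᶠ u
  ...   | yes own  = g , own , λ t → ¬imp (λ _ → t)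
  ...   | no ¬own  = contradiction (λ own → contradiction own ¬own) ¬imp

  cellSum : Fin (n G) → Fin (n H) → ℕ
  cellSum u h = ∑[ g < n G ] ([ owner g ≟ᶠ u ] * Fₙ g h)

  ≤-cellSum : ∀ {g u} h → owner g ≡ u → Fₙ g h ≤ cellSum u h
  ≤-cellSum {g} {u} h own = subst (_≤ cellSum u h) term≡Fₙ (≤-sum _ g)
    where
    term≡Fₙ : [ owner g ≟ᶠ u ] * Fₙ g h ≡ Fₙ g h
    term≡Fₙ = trans (cong (_* Fₙ g h) ([]-yes (owner g ≟ᶠ u) own)) (*-identityˡ _)

  cellSum-partition : ∀ h → ∑[ u < n G ] cellSum u h ≡ ∑[ g < n G ] Fₙ g h
  cellSum-partition h =
    trans (∑-comm (λ u g → [ owner g ≟ᶠ u ] * Fₙ g h))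
          (sum-cong-≗ (λ g → sum-δ (owner g) (Fₙ g h)))

  column : Fin (n G) → Fin (n H) → Fin 3
  column u h with covered? u h
  ... | yes _ = suc zero
  ... | no  _ = clamp (cellSum u h)

  column-two : ∀ {g u h} → owner g ≡ u → Fₙ g h ≡ 2 → toℕ (column u h) ≡ 2
  column-two {g} {u} {h} own F≡2 with covered? u h
  ... | yes cov = contradiction (trans (sym F≡2) (proj₁ (witnessInG-sound g h (cov g own)))) λ ()
  ... | no _    = clamp-≡2 (≤-trans (≤-reflexive (sym F≡2)) (≤-cellSum h own))

  column-roman : ∀ u → IsRomanDominating H (column u)
  column-roman u h col≡0 with covered? u h
  ... | yes _   = contradiction col≡0 λ ()
  ... | no ¬cov =
    let g , own , ¬t = uncovered-witness ¬cov
        Fg≡0 = n≤0⇒n≡0 (≤-trans (≤-cellSum h own) (≤-reflexive (clamp-≡0 _ col≡0)))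
        h′ , adj , F≡2 = witnessInG-complete g h Fg≡0 ¬t
    in h′ , adj , column-two own F≡2

  column-weight : ∀ u → weight H (column u) ≤ ∑[ h < n H ] (cellSum u h + [ covered? u h ])
  column-weight u = ≤-trans (≤-reflexive (weight≡sum H (column u))) (sum-mono-≤ column-≤)
    where
    column-≤ : ∀ h → toℕ (column u h) ≤ cellSum u h + [ covered? u h ]
    column-≤ h with covered? u h
    ... | yes _ = m≤n+m 1 _
    ... | no  _ = ≤-trans (clamp-≤ _) (m≤m+n _ 0)

  layer : Fin (n H) → Fin (n G) → Fin 3
  layer h g = clamp (Fₙ g h + φₙ g * [ ¬? (covered? (owner g) h) ])

  layer-two-owner : ∀ h g → ¬ Covered (owner g) h → φₙ (owner g) ≡ 2 → toℕ (layer h (owner g)) ≡ 2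
  layer-two-owner h g ¬cov φ≡2 = clamp-≡2 (≤-trans (≤-reflexive (sym φ-part≡2)) (m≤n+m _ _))
    where
    open ≡-Reasoning
    φ-part≡2 : φₙ (owner g) * [ ¬? (covered? (owner (owner g)) h) ] ≡ 2
    φ-part≡2 = begin
      φₙ (owner g) * [ ¬? (covered? (owner (owner g)) h) ]
        ≡⟨ cong (λ u → φₙ (owner g) * [ ¬? (covered? u h) ]) (owner-idem g) ⟩
      φₙ (owner g) * [ ¬? (covered? (owner g) h) ]
        ≡⟨ cong (φₙ (owner g) *_) ([]-yes (¬? (covered? (owner g) h)) ¬cov) ⟩
      φₙ (owner g) * 1
        ≡⟨ *-identityʳ _ ⟩
      φₙ (owner g)
        ≡⟨ φ≡2 ⟩
      2 ∎

  layer-roman : ∀ h → IsRomanDominating G (layer h)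
  layer-roman h g layer≡0 with covered? (owner g) h
  ... | yes cov =
    let _ , g′ , adj , F≡2 = witnessInG-sound g h (cov g refl)
    in g′ , adj , clamp-≡2 (≤-trans (≤-reflexive (sym F≡2)) (m≤m+n _ _))
  ... | no ¬cov =
    let φg≡0 = trans (sym (*-identityʳ _)) (m+n≡0⇒n≡0 (Fₙ g h) (clamp-≡0 _ layer≡0))
        adj , φ≡2 = owner-adj g φg≡0
    in owner g , adj , layer-two-owner h g ¬cov φ≡2

  layer-valued : ∀ h → ValuedIn P (layer h)
  layer-valued h g =
    clamp-closed (+-closed (F-valued (combine g h))
                           (*-[]-closed (¬? (covered? (owner g) h)) (φ-valued g)))

  coveredMass : Fin (n G) → Fin (n H) → ℕ
  coveredMass u h = φₙ u * [ covered? u h ]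

  layer-bound : ∀ h → ∑[ u < n G ] coveredMass u h ≤ ∑[ g < n G ] Fₙ g h
  layer-bound h = +-cancelʳ-≤ (∑[ g < n G ] uncov g) _ _ (begin
    ∑[ u < n G ] coveredMass u h + ∑[ g < n G ] uncov g
      ≡⟨ cong (_+ ∑[ g < n G ] uncov g)
              (sum-cong-≗ (λ g → sym (φ-*-owner (λ u → [ covered? u h ]) g))) ⟩
    ∑[ g < n G ] (φₙ g * [ covered? (owner g) h ]) + ∑[ g < n G ] uncov g
      ≡⟨ sym (∑-distrib-+ _ uncov) ⟩
    ∑[ g < n G ] (φₙ g * [ covered? (owner g) h ] + uncov g)
      ≡⟨ sum-cong-≗ (λ g → *-[]-split (φₙ g) (covered? (owner g) h)) ⟨
    ∑[ g < n G ] φₙ g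
      ≡⟨ weight≡sum G φ ⟨
    weight G φ
      ≤⟨ φ-minimal (layer h) (layer-roman h) (layer-valued h) ⟩
    weight G (layer h)
      ≡⟨ weight≡sum G (layer h) ⟩
    ∑[ g < n G ] toℕ (layer h g)
      ≤⟨ sum-mono-≤ (λ g → clamp-≤ (Fₙ g h + uncov g)) ⟩
    ∑[ g < n G ] (Fₙ g h + uncov g)
      ≡⟨ ∑-distrib-+ (λ g → Fₙ g h) uncov ⟩
    ∑[ g < n G ] Fₙ g h + ∑[ g < n G ] uncov g ∎)
    where
    open ≤-Reasoning
    uncov : Fin (n G) → ℕ
    uncov g = φₙ g * [ ¬? (covered? (owner g) h) ]

  cell-bound : ∀ {c} → RomanLowerBound H c → ∀ u →
    φₙ u * c ≤ 2 * ∑[ h < n H ] cellSum u h + ∑[ h < n H ] coveredMass u h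
  cell-bound {c} c≤ u = begin
    φₙ u * c
      ≤⟨ *-monoʳ-≤ (φₙ u) (≤-trans (c≤ (column u) (column-roman u)) (column-weight u)) ⟩
    φₙ u * ∑[ h < n H ] (cellSum u h + [ covered? u h ])
      ≡⟨ *-distribˡ-sum (φₙ u) (λ h → cellSum u h + [ covered? u h ]) ⟩
    ∑[ h < n H ] (φₙ u * (cellSum u h + [ covered? u h ]))
      ≤⟨ sum-mono-≤ term-≤ ⟩
    ∑[ h < n H ] (2 * cellSum u h + coveredMass u h)
      ≡⟨ ∑-distrib-+ (λ h → 2 * cellSum u h) (coveredMass u) ⟩
    ∑[ h < n H ] (2 * cellSum u h) + ∑[ h < n H ] coveredMass u h
      ≡⟨ cong (_+ ∑[ h < n H ] coveredMass u h) (*-distribˡ-sum 2 (cellSum u)) ⟨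
    2 * ∑[ h < n H ] cellSum u h + ∑[ h < n H ] coveredMass u h ∎
    where
    open ≤-Reasoning
    term-≤ : ∀ h → φₙ u * (cellSum u h + [ covered? u h ]) ≤ 2 * cellSum u h + coveredMass u h
    term-≤ h =
      ≤-trans (≤-reflexive (*-distribˡ-+ (φₙ u) _ _)) (+-monoˡ-≤ _ (*-monoˡ-≤ _ (φ≤2 u)))

  W : ℕ
  W = ∑[ g < n G ] ∑[ h < n H ] Fₙ g h

  weight-□≡W : weight (G □ H) F ≡ W
  weight-□≡W = trans (weight≡sum (G □ H) F) (sum-combine (n G) (toℕ ∘ F))

  cellSum-total : ∑[ u < n G ] ∑[ h < n H ] cellSum u h ≡ W
  cellSum-total = begin
    ∑[ u < n G ] ∑[ h < n H ] cellSum u h ≡⟨ ∑-comm cellSum ⟩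
    ∑[ h < n H ] ∑[ u < n G ] cellSum u h ≡⟨ sum-cong-≗ cellSum-partition ⟩
    ∑[ h < n H ] ∑[ g < n G ] Fₙ g h     ≡⟨ ∑-comm (λ h g → Fₙ g h) ⟩
    W ∎
    where open ≡-Reasoning

  weight*≤3*weight : ∀ {c} → RomanLowerBound H c → weight G φ * c ≤ 3 * weight (G □ H) F
  weight*≤3*weight {c} c≤ = begin
    weight G φ * c
      ≡⟨ cong (_* c) (weight≡sum G φ) ⟩
    (∑[ u < n G ] φₙ u) * c
      ≡⟨ *-distribʳ-sum c φₙ ⟩
    ∑[ u < n G ] (φₙ u * c)
      ≤⟨ sum-mono-≤ (cell-bound c≤) ⟩
    ∑[ u < n G ] (2 * ∑[ h < n H ] cellSum u h + ∑[ h < n H ] coveredMass u h)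
      ≡⟨ ∑-distrib-+ (λ u → 2 * ∑[ h < n H ] cellSum u h) (λ u → ∑[ h < n H ] coveredMass u h) ⟩
    ∑[ u < n G ] (2 * ∑[ h < n H ] cellSum u h) + ∑[ u < n G ] ∑[ h < n H ] coveredMass u h
      ≡⟨ cong₂ _+_ (trans (sym (*-distribˡ-sum 2 λ u → ∑[ h < n H ] cellSum u h))
                          (cong (2 *_) cellSum-total))
                   (∑-comm coveredMass) ⟩
    2 * W + ∑[ h < n H ] ∑[ u < n G ] coveredMass u h
      ≤⟨ +-monoʳ-≤ (2 * W) (sum-mono-≤ layer-bound) ⟩
    2 * W + ∑[ h < n H ] ∑[ g < n G ] Fₙ g h
      ≡⟨ cong (2 * W +_) (∑-comm (λ h g → Fₙ g h)) ⟩
    2 * W + W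
      ≡⟨ +-comm (2 * W) W ⟩
    3 * W
      ≡⟨ cong (3 *_) weight-□≡W ⟨
    3 * weight (G □ H) F ∎
    where open ≤-Reasoning

all-values : IsClampClosedSubmonoid (λ _ → ⊤)
all-values = record { 0-closed = tt ; +-closed = λ _ _ → tt ; clamp-closed = λ _ → tt }

evens : IsClampClosedSubmonoid (2 ∣_)
evens = record { 0-closed = 2 ∣0 ; +-closed = ∣m∣n⇒∣m+n ; clamp-closed = clamp-even }
  where
  clamp-even : ∀ {x} → 2 ∣ x → 2 ∣ toℕ (clamp x)
  clamp-even {0}           _   = 2 ∣0
  clamp-even {1}           2∣1 = contradiction (∣1⇒≡1 2∣1) λ ()
  clamp-even {suc (suc _)} _   = ∣-refl

γR-product : ∀ G H a b c → IsRomanDominationNumber (G □ H) a → IsRomanDominationNumber G b →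
  IsRomanDominationNumber H c → b * c ≤ 3 * a
γR-product G H _ _ _ ((F , F-roman , refl) , _) ((φ , φ-roman , refl) , φ-minimal) (_ , c≤) =
  ProductBound.weight*≤3*weight all-values G H
    φ φ-roman (λ _ → tt) (λ ψ ψ-roman _ → φ-minimal ψ ψ-roman)
    F F-roman (λ _ → tt) c≤

twice : ∀ {k} → Subset k → Fin k → Fin 3
twice X x = if does (x ∈? X) then suc (suc zero) else zero

twice-even : ∀ {k} (X : Subset k) → ValuedIn (2 ∣_) (twice X)
twice-even X x with x ∈? X
... | yes _ = ∣-refl
... | no  _ = 2 ∣0

∣∣≡sum : ∀ {k} (X : Subset k) → ∣ X ∣ ≡ ∑[ x < k ] [ x ∈? X ]
∣∣≡sum []          = refl
∣∣≡sum (true  ∷ X) = cong suc (∣∣≡sum X)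
∣∣≡sum (false ∷ X) = ∣∣≡sum X

weight-twice : ∀ G X → weight G (twice X) ≡ 2 * ∣ X ∣
weight-twice G X = begin
  weight G (twice X)            ≡⟨ weight≡sum G (twice X) ⟩
  ∑[ x < n G ] toℕ (twice X x)  ≡⟨ sum-cong-≗ twice≡2*[] ⟩
  ∑[ x < n G ] (2 * [ x ∈? X ]) ≡⟨ *-distribˡ-sum 2 (λ x → [ x ∈? X ]) ⟨
  2 * ∑[ x < n G ] [ x ∈? X ]   ≡⟨ cong (2 *_) (∣∣≡sum X) ⟨
  2 * ∣ X ∣ ∎
  where
  open ≡-Reasoning
  twice≡2*[] : ∀ x → toℕ (twice X x) ≡ 2 * [ x ∈? X ]
  twice≡2*[] x with x ∈? X
  ... | yes _ = refl
  ... | no  _ = refl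

weight-cong : ∀ G {f g : Fin (n G) → Fin 3} → (∀ v → f v ≡ g v) → weight G f ≡ weight G g
weight-cong G {f} {g} f≗g =
  trans (weight≡sum G f) (trans (sum-cong-≗ (cong toℕ ∘ f≗g)) (sym (weight≡sum G g)))

roman-cong : ∀ G {f g : Fin (n G) → Fin 3} → (∀ v → f v ≡ g v) →
  IsRomanDominating G f → IsRomanDominating G g
roman-cong G f≗g f-roman v gv≡0 =
  let u , adj , fu≡2 = f-roman v (trans (cong toℕ (f≗g v)) gv≡0)
  in u , adj , trans (cong toℕ (sym (f≗g u))) fu≡2

twice≡2⇔∈ : ∀ {k} (X : Subset k) x → toℕ (twice X x) ≡ 2 ⇔ x ∈ X
twice≡2⇔∈ X x with x ∈? X
... | yes x∈X = mk⇔ (const x∈X) (const refl)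
... | no  x∉X = mk⇔ (λ ()) (λ x∈X → contradiction x∈X x∉X)

twice≡0⇔∉ : ∀ {k} (X : Subset k) x → toℕ (twice X x) ≡ 0 ⇔ x ∉ X
twice≡0⇔∉ X x with x ∈? X
... | yes x∈X = mk⇔ (λ ()) (λ x∉X → contradiction x∈X x∉X)
... | no  x∉X = mk⇔ (const x∉X) (const refl)

dominating⇒twice-roman : ∀ G {X} → IsDominating G X → IsRomanDominating G (twice X)
dominating⇒twice-roman G {X} X-dom v twice≡0 =
  let u , u∈X , adj = X-dom v (Equivalence.to (twice≡0⇔∉ X v) twice≡0)
  in u , adj , Equivalence.from (twice≡2⇔∈ X u) u∈X

twice-roman⇒dominating : ∀ G {X} → IsRomanDominating G (twice X) → IsDominating G X
twice-roman⇒dominating G {X} twice-roman v v∉X =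
  let u , adj , twice≡2 = twice-roman v (Equivalence.from (twice≡0⇔∉ X v) v∉X)
  in u , Equivalence.to (twice≡2⇔∈ X u) twice≡2 , adj

twos : ∀ {k} → (Fin k → Fin 3) → Subset k
twos ψ = tabulate (λ v → toℕ (ψ v) ≡ᵇ 2)

∈-twos⇔ : ∀ {k} (ψ : Fin k → Fin 3) v → v ∈ twos ψ ⇔ toℕ (ψ v) ≡ 2
∈-twos⇔ ψ v = mk⇔
  (λ v∈ → ≡ᵇ⇒≡ _ 2 (subst T (trans (sym ([]=⇒lookup v∈)) (lookup∘tabulate _ v)) tt))
  (λ ψv≡2 → lookup⇒[]= v (twos ψ)
               (trans (lookup∘tabulate _ v) (Equivalence.to T-≡ (≡⇒≡ᵇ _ 2 ψv≡2))))

even⇒twice-twos : ∀ {k} (ψ : Fin k → Fin 3) → ValuedIn (2 ∣_) ψ → ∀ v → ψ v ≡ twice (twos ψ) v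
even⇒twice-twos ψ ψ-even v with v ∈? twos ψ
... | yes v∈ = toℕ-injective (Equivalence.to (∈-twos⇔ ψ v) v∈)
... | no  v∉ =
  toℕ-injective (zero-or-two (ψ v) (ψ-even v) (v∉ ∘ Equivalence.from (∈-twos⇔ ψ v)))
  where
  zero-or-two : ∀ x → 2 ∣ toℕ x → toℕ x ≢ 2 → toℕ x ≡ 0
  zero-or-two zero             _   _   = refl
  zero-or-two (suc zero)       2∣1 _   = contradiction (∣1⇒≡1 2∣1) λ ()
  zero-or-two (suc (suc zero)) _   ≢2  = contradiction refl ≢2

twice-minimal : ∀ G {U} → (∀ D → IsDominating G D → ∣ U ∣ ≤ ∣ D ∣) → MinimalRomanIn (2 ∣_) G (twice U)
twice-minimal G {U} U-minimal ψ ψ-roman ψ-even = begin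
  weight G (twice U)         ≡⟨ weight-twice G U ⟩
  2 * ∣ U ∣                  ≤⟨ *-monoʳ-≤ 2 (U-minimal (twos ψ) (twice-roman⇒dominating G twos-roman)) ⟩
  2 * ∣ twos ψ ∣             ≡⟨ weight-twice G (twos ψ) ⟨
  weight G (twice (twos ψ))  ≡⟨ weight-cong G (even⇒twice-twos ψ ψ-even) ⟨
  weight G ψ                 ∎
  where
  open ≤-Reasoning
  twos-roman : IsRomanDominating G (twice (twos ψ))
  twos-roman = roman-cong G (even⇒twice-twos ψ ψ-even) ψ-roman

γ-product : ∀ G H a b c → IsDominationNumber (G □ H) a → IsDominationNumber G b →
  IsRomanDominationNumber H c → b * c ≤ 3 * a
γ-product G H _ _ c ((D , D-dom , refl) , _) ((U , U-dom , refl) , U-minimal) (_ , c≤) =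
  *-cancelˡ-≤ 2 (begin
    2 * (∣ U ∣ * c)               ≡⟨ *-assoc 2 ∣ U ∣ c ⟨
    2 * ∣ U ∣ * c                 ≡⟨ cong (_* c) (weight-twice G U) ⟨
    weight G (twice U) * c        ≤⟨ bound ⟩
    3 * weight (G □ H) (twice D)  ≡⟨ cong (3 *_) (weight-twice (G □ H) D) ⟩
    3 * (2 * ∣ D ∣)               ≡⟨ *-assoc 3 2 ∣ D ∣ ⟨
    6 * ∣ D ∣                     ≡⟨ *-assoc 2 3 ∣ D ∣ ⟩
    2 * (3 * ∣ D ∣)               ∎)
  where
  open ≤-Reasoning
  bound : weight G (twice U) * c ≤ 3 * weight (G □ H) (twice D)
  bound = ProductBound.weight*≤3*weight evens G H
    (twice U) (dominating⇒twice-roman G U-dom) (twice-even U) (twice-minimal G U-minimal)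
    (twice D) (dominating⇒twice-roman (G □ H) D-dom) (twice-even D) c≤

corollary4 : (G H : Graph) →
    (∀ a b c → IsRomanDominationNumber (G □ H) a → IsRomanDominationNumber G b →
      IsRomanDominationNumber H c → b * c ≤ 3 * a)
    × (∀ a b c → IsDominationNumber (G □ H) a → IsDominationNumber G b →
      IsRomanDominationNumber H c → b * c ≤ 3 * a)
corollary4 G H = γR-product G H , γ-product G H
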